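{- Let $q\in\mathbb{C}$ with $|q|<1$. For every integer $j\ge0$, \[ \sum_{n=0}^{j}\frac{(-1)^nq^{n(n+1)/2}}{(q)_n}=\sum_{n=0}^{j}\frac{(j+1-n)(-1)^nq^{n(n-1)/2}}{(q)_n}=\frac{(j+1)(-1)^jq^{j(j+1)/2}}{(q)_j}-\sum_{n=0}^{j}\frac{n(-1)^nq^{n(n-1)/2}}{(q)_n}. \]
   Context: $(q)_n=(q;q)_n=\prod_{i=1}^{n}(1-q^i)$ for $n\ge0$ (empty product $=1$). -}

module Defs where

open import Level using (Level)
open import Data.Nat as ℕ using (ℕ; zero; suc)
open import Algebra.Bundles using (CommutativeRing)

module QSeries {c ℓ : Level} (R : CommutativeRing c ℓ) where
  open CommutativeRing R

  pow : Carrier → ℕ → Carrier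
  pow x zero    = 1#
  pow x (suc n) = x * pow x n

  fromℕ : ℕ → Carrier
  fromℕ zero    = 0#
  fromℕ (suc n) = 1# + fromℕ n

  sgn : ℕ → Carrier
  sgn n = pow (- 1#) n

  qPoch : Carrier → ℕ → Carrier
  qPoch q zero    = 1#
  qPoch q (suc n) = qPoch q n * (1# - pow q (suc n))

  sumTo : ℕ → (ℕ → Carrier) → Carrier
  sumTo zero    f = f 0
  sumTo (suc j) f = sumTo j f + f (suc j)

  -- n(n+1)/2 and n(n-1)/2 as natural numbers
  tri : ℕ → ℕ
  tri zero    = 0
  tri (suc n) = suc n ℕ.+ tri n

  tri' : ℕ → ℕ
  tri' zero    = 0
  tri' (suc n) = tri n

-- The terms e n = (-1)^n q^{n(n-1)/2} / (q)_n telescope: since (q)_{n+1} = (q)_n (1 - q^{n+1}),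
-- e (n+1) = E (n+1) - E n for E n = (-1)^n q^{n(n+1)/2} / (q)_n, so Σ_{n≤m} e n = E m.
-- Summing this over m ≤ j counts each e n exactly j+1-n times, which is the first equality;
-- splitting the weight j+1-n as (j+1) - n and using Σ_{n≤j} e n = E j once more gives the second.
module Submission where

open import Defs
open import Level using (Level)
open import Data.Nat using (ℕ; suc; _≤_; _∸_)
open import Data.Product using (_×_)
open import Algebra.Bundles using (CommutativeRing)
import Data.Nat as ℕ
open import Data.Nat using (zero; _<_)
open import Data.Nat.Properties using (≤-trans; ≤-refl; m≤n⇒m≤1+n; <⇒≤; +-∸-assoc; m+[n∸m]≡n; n∸n≡0)
open import Data.Product using (_,_)
import Relation.Binary.PropositionalEquality as ≡
import Relation.Binary.Reasoning.Setoid as SetoidReasoning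

module QSeriesProperties {c ℓ : Level} (R : CommutativeRing c ℓ) where
  open CommutativeRing R
  open QSeries R
  open SetoidReasoning setoid
  open import Algebra.Properties.Ring ring using (-1*x≈-x; -‿distribˡ-*; x[y-z]≈xy-xz; [y-z]x≈yx-zx)
  open import Algebra.Properties.AbelianGroup +-abelianGroup using (xyx⁻¹≈y; ⁻¹-∙-comm)
  open import Algebra.Properties.CommutativeSemigroup +-commutativeSemigroup using (interchange)
  open import Algebra.Solver.Ring.NaturalCoefficients.Default commutativeSemiring using (solve; _:*_; _:=_)

  w*x*y*z≈w*[x*y*z] : ∀ w x y z → w * x * y * z ≈ w * (x * y * z)
  w*x*y*z≈w*[x*y*z] w x y z = trans (*-congʳ (*-assoc w x y)) (*-assoc w (x * y) z)

  -1*x*y*z≈-[x*y*z] : ∀ x y z → - 1# * x * y * z ≈ - (x * y * z)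
  -1*x*y*z≈-[x*y*z] x y z = begin
    - 1# * x * y * z   ≈⟨ *-congʳ (*-congʳ (-1*x≈-x x)) ⟩
    - x * y * z        ≈⟨ *-congʳ (-‿distribˡ-* x y) ⟨
    - (x * y) * z      ≈⟨ -‿distribˡ-* (x * y) z ⟨
    - (x * y * z)      ∎

  x*a≈1⇒y*[a*b]≈1⇒x≈y*b : ∀ {x y a b} → x * a ≈ 1# → y * (a * b) ≈ 1# → x ≈ y * b
  x*a≈1⇒y*[a*b]≈1⇒x≈y*b {x} {y} {a} {b} xa≈1 yab≈1 = begin
    x                ≈⟨ *-identityʳ x ⟨
    x * 1#           ≈⟨ *-congˡ yab≈1 ⟨
    x * (y * (a * b)) ≈⟨ solve 4 (λ x y a b → x :* (y :* (a :* b)) := (x :* a) :* (y :* b)) refl x y a b ⟩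
    (x * a) * (y * b) ≈⟨ *-congʳ xa≈1 ⟩
    1# * (y * b)     ≈⟨ *-identityˡ (y * b) ⟩
    y * b            ∎

  pow-+ : ∀ x m n → pow x (m ℕ.+ n) ≈ pow x m * pow x n
  pow-+ x zero    n = sym (*-identityˡ (pow x n))
  pow-+ x (suc m) n = trans (*-congˡ (pow-+ x m n)) (sym (*-assoc x (pow x m) (pow x n)))

  fromℕ-+ : ∀ m n → fromℕ (m ℕ.+ n) ≈ fromℕ m + fromℕ n
  fromℕ-+ zero    n = sym (+-identityˡ (fromℕ n))
  fromℕ-+ (suc m) n = trans (+-congˡ (fromℕ-+ m n)) (sym (+-assoc 1# (fromℕ m) (fromℕ n)))

  fromℕ-∸ : ∀ {m n} → n ≤ m → fromℕ (m ∸ n) ≈ fromℕ m - fromℕ n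
  fromℕ-∸ {m} {n} n≤m = begin
    fromℕ (m ∸ n)                   ≈⟨ xyx⁻¹≈y (fromℕ n) (fromℕ (m ∸ n)) ⟨
    fromℕ n + fromℕ (m ∸ n) - fromℕ n ≈⟨ +-congʳ (fromℕ-+ n (m ∸ n)) ⟨
    fromℕ (n ℕ.+ (m ∸ n)) - fromℕ n   ≡⟨ ≡.cong (λ k → fromℕ k - fromℕ n) (m+[n∸m]≡n n≤m) ⟩
    fromℕ m - fromℕ n               ∎

  fromℕ-suc-* : ∀ n x → fromℕ (suc n) * x ≈ fromℕ n * x + x
  fromℕ-suc-* n x = begin
    (1# + fromℕ n) * x    ≈⟨ distribʳ x 1# (fromℕ n) ⟩
    1# * x + fromℕ n * x  ≈⟨ +-congʳ (*-identityˡ x) ⟩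
    x + fromℕ n * x       ≈⟨ +-comm x (fromℕ n * x) ⟩
    fromℕ n * x + x       ∎

  sumTo-cong : ∀ j {f g : ℕ → Carrier} → (∀ n → n ≤ j → f n ≈ g n) → sumTo j f ≈ sumTo j g
  sumTo-cong zero    f≈g = f≈g 0 ℕ.z≤n
  sumTo-cong (suc j) f≈g =
    +-cong (sumTo-cong j (λ n n≤j → f≈g n (m≤n⇒m≤1+n n≤j))) (f≈g (suc j) ≤-refl)

  sumTo-+ : ∀ j (f g : ℕ → Carrier) → sumTo j (λ n → f n + g n) ≈ sumTo j f + sumTo j g
  sumTo-+ zero    f g = refl
  sumTo-+ (suc j) f g =
    trans (+-congʳ (sumTo-+ j f g)) (interchange (sumTo j f) (sumTo j g) (f (suc j)) (g (suc j)))

  sumTo-neg : ∀ j (f : ℕ → Carrier) → sumTo j (λ n → - f n) ≈ - sumTo j f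
  sumTo-neg zero    f = refl
  sumTo-neg (suc j) f = trans (+-congʳ (sumTo-neg j f)) (⁻¹-∙-comm (sumTo j f) (f (suc j)))

  sumTo-- : ∀ j (f g : ℕ → Carrier) → sumTo j (λ n → f n - g n) ≈ sumTo j f - sumTo j g
  sumTo-- j f g = trans (sumTo-+ j f (λ n → - g n)) (+-congˡ (sumTo-neg j g))

  sumTo-*ˡ : ∀ j x (f : ℕ → Carrier) → sumTo j (λ n → x * f n) ≈ x * sumTo j f
  sumTo-*ˡ zero    x f = refl
  sumTo-*ˡ (suc j) x f = trans (+-congʳ (sumTo-*ˡ j x f)) (sym (distribˡ x (sumTo j f) (f (suc j))))

  sumTo-telescope : ∀ j {f g : ℕ → Carrier} → f 0 ≈ g 0 →
                    (∀ n → n < j → g n + f (suc n) ≈ g (suc n)) → sumTo j f ≈ g j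
  sumTo-telescope zero    f0≈g0 step = f0≈g0
  sumTo-telescope (suc j) f0≈g0 step =
    trans (+-congʳ (sumTo-telescope j f0≈g0 (λ n n<j → step n (m≤n⇒m≤1+n n<j)))) (step j ≤-refl)

  sumTo-partialSums : ∀ j (f : ℕ → Carrier) →
                      sumTo j (λ m → sumTo m f) ≈ sumTo j (λ n → fromℕ (suc j ∸ n) * f n)
  sumTo-partialSums zero    f = sym (trans (*-congʳ (+-identityʳ 1#)) (*-identityˡ (f 0)))
  sumTo-partialSums (suc j) f = begin
    sumTo j (λ m → sumTo m f) + sumTo (suc j) f
      ≈⟨ +-congʳ (sumTo-partialSums j f) ⟩
    sumTo j weighted + sumTo (suc j) f
      ≈⟨ +-congʳ (trans (+-congˡ lastWeightVanishes) (+-identityʳ (sumTo j weighted))) ⟨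
    sumTo (suc j) weighted + sumTo (suc j) f
      ≈⟨ sumTo-+ (suc j) weighted f ⟨
    sumTo (suc j) (λ n → weighted n + f n)
      ≈⟨ sumTo-cong (suc j) shiftWeight ⟨
    sumTo (suc j) (λ n → fromℕ (suc (suc j) ∸ n) * f n) ∎
    where
    weighted : ℕ → Carrier
    weighted n = fromℕ (suc j ∸ n) * f n

    lastWeightVanishes : weighted (suc j) ≈ 0#
    lastWeightVanishes rewrite n∸n≡0 j = zeroˡ (f (suc j))

    shiftWeight : ∀ n → n ≤ suc j → fromℕ (suc (suc j) ∸ n) * f n ≈ weighted n + f n
    shiftWeight n n≤1+j rewrite +-∸-assoc 1 n≤1+j = fromℕ-suc-* (suc j ∸ n) (f n)

  sumTo-reversedWeights : ∀ j (f : ℕ → Carrier) →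
    sumTo j (λ n → fromℕ (suc j ∸ n) * f n)
      ≈ fromℕ (suc j) * sumTo j f - sumTo j (λ n → fromℕ n * f n)
  sumTo-reversedWeights j f = begin
    sumTo j (λ n → fromℕ (suc j ∸ n) * f n)
      ≈⟨ sumTo-cong j splitWeight ⟩
    sumTo j (λ n → fromℕ (suc j) * f n - fromℕ n * f n)
      ≈⟨ sumTo-- j (λ n → fromℕ (suc j) * f n) (λ n → fromℕ n * f n) ⟩
    sumTo j (λ n → fromℕ (suc j) * f n) - sumTo j (λ n → fromℕ n * f n)
      ≈⟨ +-congʳ (sumTo-*ˡ j (fromℕ (suc j)) f) ⟩
    fromℕ (suc j) * sumTo j f - sumTo j (λ n → fromℕ n * f n) ∎
    where
    splitWeight : ∀ n → n ≤ j → fromℕ (suc j ∸ n) * f n ≈ fromℕ (suc j) * f n - fromℕ n * f n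
    splitWeight n n≤j =
      trans (*-congʳ (fromℕ-∸ (m≤n⇒m≤1+n n≤j))) ([y-z]x≈yx-zx (f n) (fromℕ (suc j)) (fromℕ n))

  module Euler (q : Carrier) (inv : ℕ → Carrier) where

    euler euler⁺ : ℕ → Carrier
    euler  n = sgn n * pow q (tri' n) * inv n
    euler⁺ n = sgn n * pow q (tri n) * inv n

    euler-step : ∀ n → inv n * qPoch q n ≈ 1# → inv (suc n) * qPoch q (suc n) ≈ 1# →
                 euler⁺ n + euler (suc n) ≈ euler⁺ (suc n)
    euler-step n invₙ inv₁₊ₙ = begin
      s * P * inv n + - 1# * s * P * I
        ≈⟨ +-cong (*-congˡ (x*a≈1⇒y*[a*b]≈1⇒x≈y*b invₙ inv₁₊ₙ)) (-1*x*y*z≈-[x*y*z] s P I) ⟩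
      s * P * (I * (1# - Q)) - e
        ≈⟨ +-congʳ (*-assoc (s * P) I (1# - Q)) ⟨
      e * (1# - Q) - e
        ≈⟨ +-congʳ (trans (x[y-z]≈xy-xz e 1# Q) (+-congʳ (*-identityʳ e))) ⟩
      e - e * Q - e
        ≈⟨ xyx⁻¹≈y e (- (e * Q)) ⟩
      - (e * Q)
        ≈⟨ -‿cong (solve 4 (λ s P I Q → s :* P :* I :* Q := s :* (Q :* P) :* I) refl s P I Q) ⟩
      - (s * (Q * P) * I)
        ≈⟨ -1*x*y*z≈-[x*y*z] s (Q * P) I ⟨
      - 1# * s * (Q * P) * I
        ≈⟨ *-congʳ (*-congˡ (pow-+ q (suc n) (tri n))) ⟨
      euler⁺ (suc n) ∎
      where
      s P Q I e : Carrier
      s = sgn n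
      P = pow q (tri n)
      Q = pow q (suc n)
      I = inv (suc n)
      e = s * P * I

    euler-partialSum : ∀ m → (∀ n → n ≤ m → inv n * qPoch q n ≈ 1#) → sumTo m euler ≈ euler⁺ m
    euler-partialSum m inverses = sumTo-telescope m refl
      (λ n n<m → euler-step n (inverses n (<⇒≤ n<m)) (inverses (suc n) n<m))

corollary6p3 : {c ℓ : Level} (R : CommutativeRing c ℓ) →
  let open CommutativeRing R
      open QSeries R
  in (q : Carrier) (j : ℕ) (inv : ℕ → Carrier) →
     (∀ n → n ≤ j → inv n * qPoch q n ≈ 1#) →
     (sumTo j (λ n → sgn n * pow q (tri n) * inv n)
       ≈ sumTo j (λ n → fromℕ (suc j ∸ n) * sgn n * pow q (tri' n) * inv n))
     × (sumTo j (λ n → fromℕ (suc j ∸ n) * sgn n * pow q (tri' n) * inv n)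
       ≈ (fromℕ (suc j) * sgn j * pow q (tri j) * inv j
          - sumTo j (λ n → fromℕ n * sgn n * pow q (tri' n) * inv n)))
corollary6p3 R q j inv inverses = countedPartialSums , splitWeights
  where
  open CommutativeRing R
  open QSeries R
  open QSeriesProperties R
  open Euler q inv
  open SetoidReasoning setoid

  weighted : (ℕ → ℕ) → ℕ → Carrier
  weighted w n = fromℕ (w n) * sgn n * pow q (tri' n) * inv n

  euler-weighted : ∀ w → sumTo j (weighted w) ≈ sumTo j (λ n → fromℕ (w n) * euler n)
  euler-weighted w = sumTo-cong j (λ n _ → w*x*y*z≈w*[x*y*z] (fromℕ (w n)) (sgn n) (pow q (tri' n)) (inv n))

  countedPartialSums : sumTo j euler⁺ ≈ sumTo j (weighted (suc j ∸_))
  countedPartialSums = begin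
    sumTo j euler⁺
      ≈⟨ sumTo-cong j (λ m m≤j → euler-partialSum m (λ n n≤m → inverses n (≤-trans n≤m m≤j))) ⟨
    sumTo j (λ m → sumTo m euler)
      ≈⟨ sumTo-partialSums j euler ⟩
    sumTo j (λ n → fromℕ (suc j ∸ n) * euler n)
      ≈⟨ euler-weighted (suc j ∸_) ⟨
    sumTo j (weighted (suc j ∸_)) ∎

  splitWeights : sumTo j (weighted (suc j ∸_))
                   ≈ fromℕ (suc j) * sgn j * pow q (tri j) * inv j - sumTo j (weighted (λ n → n))
  splitWeights = begin
    sumTo j (weighted (suc j ∸_))
      ≈⟨ euler-weighted (suc j ∸_) ⟩
    sumTo j (λ n → fromℕ (suc j ∸ n) * euler n)
      ≈⟨ sumTo-reversedWeights j euler ⟩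
    fromℕ (suc j) * sumTo j euler - sumTo j (λ n → fromℕ n * euler n)
      ≈⟨ +-cong (*-congˡ (euler-partialSum j inverses)) (-‿cong (sym (euler-weighted (λ n → n)))) ⟩
    fromℕ (suc j) * euler⁺ j - sumTo j (weighted (λ n → n))
      ≈⟨ +-congʳ (w*x*y*z≈w*[x*y*z] (fromℕ (suc j)) (sgn j) (pow q (tri j)) (inv j)) ⟨
    fromℕ (suc j) * sgn j * pow q (tri j) * inv j - sumTo j (weighted (λ n → n)) ∎
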